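{- Let $T$ be a tree with $|V(T)|\ge 3$ and let $B=\{v\in V(T): d_T(v)<\Delta(T)\}$. Then for any $v\in B$ there is a $(\Delta(T)-1)$-edge-colorable subgraph $H$ of $T$ such that either $V(H)=V(T)$ or $V(T)\setminus V(H)=\{v\}$.
   Context: $\Delta(T)$ is the maximum degree of $T$. A graph is $k$-edge-colorable if its edge set can be partitioned into $k$ matchings. Here $V(H)$ denotes the set of vertices of $T$ covered by $H$, i.e. having degree at least $1$ in $H$. -}

module Defs where

open import Data.Nat using (ℕ; zero; suc; _+_; _∸_; _<_; _≤_; _≥_; _⊔_)
open import Data.Fin using (Fin)
open import Data.Bool using (Bool; true; false; if_then_else_)
open import Data.List using (List; []; _∷_; length)
open import Data.List.Relation.Unary.Unique.Propositional using (Unique)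
open import Data.List.Relation.Unary.Linked using (Linked)
open import Data.List.Base using (head; last)
open import Data.Maybe using (just)
open import Data.Product using (Σ; _×_; ∃)
open import Data.Empty using (⊥)
open import Relation.Binary.PropositionalEquality using (_≡_; _≢_)
open import Relation.Nullary using (¬_)

record Graph (n : ℕ) : Set where
  field
    adj     : Fin n → Fin n → Bool
    sym     : ∀ u v → adj u v ≡ adj v u
    irrefl  : ∀ v → adj v v ≡ false
open Graph public

Adj : ∀ {n} → Graph n → Fin n → Fin n → Set
Adj G u v = adj G u v ≡ true

count : ∀ {n} → (Fin n → Bool) → ℕ
count {zero}  f = 0
count {suc n} f = (if f Fin.zero then 1 else 0) + count (λ i → f (Fin.suc i))
  where import Data.Fin as Fin

maxF : ∀ {n} → (Fin n → ℕ) → ℕ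
maxF {zero}  f = 0
maxF {suc n} f = f Fin.zero ⊔ maxF (λ i → f (Fin.suc i))
  where import Data.Fin as Fin

degree : ∀ {n} → Graph n → Fin n → ℕ
degree G v = count (adj G v)

Δ : ∀ {n} → Graph n → ℕ
Δ G = maxF (degree G)

IsWalk : ∀ {n} → Graph n → List (Fin n) → Set
IsWalk G ws = Linked (Adj G) ws

Connected : ∀ {n} → Graph n → Set
Connected {n} G = ∀ (u v : Fin n) → Σ (List (Fin n)) λ ws →
  IsWalk G ws × head ws ≡ just u × last ws ≡ just v

IsCycle : ∀ {n} → Graph n → List (Fin n) → Set
IsCycle G [] = ⊥
IsCycle G (x ∷ xs) =
  3 ≤ length (x ∷ xs) × Unique (x ∷ xs) × IsWalk G (x ∷ xs)
  × Σ (Fin _) λ y → last (x ∷ xs) ≡ just y × Adj G y x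

Acyclic : ∀ {n} → Graph n → Set
Acyclic {n} G = ∀ (c : List (Fin n)) → ¬ IsCycle G c

IsTree : ∀ {n} → Graph n → Set
IsTree G = Connected G × Acyclic G

IsSubgraph : ∀ {n} → Graph n → Graph n → Set
IsSubgraph {n} H G = ∀ (u v : Fin n) → Adj H u v → Adj G u v

record EdgeColouring {n} (H : Graph n) (k : ℕ) : Set where
  field
    col      : (u v : Fin n) → Adj H u v → Fin k
    col-sym  : ∀ u v (p : Adj H u v) (q : Adj H v u) → col u v p ≡ col v u q
    proper   : ∀ u v w (p : Adj H u v) (q : Adj H u w) →
               v ≢ w → col u v p ≢ col u w q

EdgeColourable : ∀ {n} → Graph n → ℕ → Set
EdgeColourable H k = EdgeColouring H k

-- v ∈ V(H): v has degree at least 1 in H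
Covered : ∀ {n} → Graph n → Fin n → Set
Covered H v = 1 ≤ degree H v

module Submission where

-- Root the tree T at the given vertex v with d_T(v) < Δ(T).
-- A breadth-first search from v gives every u ≠ v a parent p(u), adjacent
-- to u and strictly closer to v.  Processing the vertices from the leaves
-- upwards, mark u ≠ v as *pendant* exactly when none of its children is
-- pendant.  The edges {u, p(u)} with u pendant form a spanning star forest
-- S of T:
--   * a pendant vertex has S-degree 1 (its only S-neighbour is its parent);
--   * every u ≠ v is covered (pendant, or the centre of a pendant child);
--   * a non-pendant u ≠ v loses its parent edge, so d_S(u) < d_T(u) ≤ Δ,
--     while d_S(v) ≤ d_T(v) < Δ, and pendant vertices have 1 < Δ.
-- A graph all of whose degrees are ≤ k and each of whose edges has an end
-- of degree 1 is k-edge-colourable (colour an edge by the position of its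
-- degree-1 end among the neighbours of the other end), so S is
-- (Δ-1)-edge-colourable, and S covers every vertex except possibly v.

open import Defs
open import Data.Nat using (ℕ; zero; suc; _+_; _∸_; _≤_; _<_; z≤n; s≤s; pred; _≟_; _≤?_; _<?_)
open import Data.Nat.Properties
open import Data.Fin using (Fin; toℕ; fromℕ<)
import Data.Fin as F
import Data.Fin.Properties as FP
import Data.Bool as B
open import Data.Bool using (Bool; true; false; _∧_; _∨_; not; if_then_else_)
open import Data.Bool.Properties using (∨-comm; ∧-zeroʳ; ∧-identityʳ)
open import Data.Product using (Σ; _×_; _,_; proj₁; proj₂)
open import Data.Sum using (_⊎_; inj₁; inj₂)
open import Data.Empty using (⊥; ⊥-elim)
open import Data.List using ([]; _∷_; length)
open import Data.List.Base using (last)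
open import Data.List.Relation.Unary.Linked using (Linked; _∷_)
open import Data.Maybe using (just)
open import Function using (_∘_)
open import Relation.Nullary using (¬_; Dec; yes; no; does)
open import Relation.Nullary.Decidable using (dec-true; dec-false)
open import Relation.Binary using (tri<; tri≈; tri>)
open import Relation.Binary.PropositionalEquality
  using (_≡_; _≢_; refl; trans; cong; cong₂; subst; ≢-sym)
  renaming (sym to ≡-sym)

∧-intro : ∀ {a b} → a ≡ true → b ≡ true → a ∧ b ≡ true
∧-intro refl refl = refl

∧-elimˡ : ∀ a {b} → a ∧ b ≡ true → a ≡ true
∧-elimˡ true _ = refl

∧-elimʳ : ∀ a {b} → a ∧ b ≡ true → b ≡ true
∧-elimʳ true p = p

∨-introˡ : ∀ {a} b → a ≡ true → a ∨ b ≡ true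
∨-introˡ b refl = refl

∨-introʳ : ∀ a {b} → b ≡ true → a ∨ b ≡ true
∨-introʳ true  _ = refl
∨-introʳ false p = p

∨-elim : ∀ a {b} → a ∨ b ≡ true → a ≡ true ⊎ b ≡ true
∨-elim true  _ = inj₁ refl
∨-elim false p = inj₂ p

true≢false : ∀ {a} → a ≡ true → a ≡ false → ⊥
true≢false refl ()

bool-cases : ∀ b → b ≡ true ⊎ b ≡ false
bool-cases true  = inj₁ refl
bool-cases false = inj₂ refl

does-sound : ∀ {A : Set} (a? : Dec A) → does a? ≡ true → A
does-sound (yes a) _ = a

_≟ᵇ_ : ∀ {n} → Fin n → Fin n → Bool
x ≟ᵇ y = does (x FP.≟ y)

anyF : ∀ {n} → (Fin n → Bool) → Bool
anyF {zero}  f = false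
anyF {suc n} f = f F.zero ∨ anyF (f ∘ F.suc)

anyF-intro : ∀ {n} (f : Fin n → Bool) a → f a ≡ true → anyF f ≡ true
anyF-intro f F.zero    p = ∨-introˡ (anyF (f ∘ F.suc)) p
anyF-intro f (F.suc a) p = ∨-introʳ (f F.zero) (anyF-intro (f ∘ F.suc) a p)

anyF-elim : ∀ {n} (f : Fin n → Bool) → anyF f ≡ true → Σ (Fin n) λ a → f a ≡ true
anyF-elim {suc n} f p with ∨-elim (f F.zero) p
... | inj₁ q = F.zero , q
... | inj₂ q with anyF-elim (f ∘ F.suc) q
...   | a , r = F.suc a , r

anyF-false : ∀ {n} (f : Fin n → Bool) → anyF f ≡ false → ∀ a → f a ≡ false
anyF-false f none a with bool-cases (f a)
... | inj₁ p = ⊥-elim (true≢false (anyF-intro f a p) none)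
... | inj₂ p = p

anyF-none : ∀ {n} (f : Fin n → Bool) → (∀ a → f a ≡ false) → anyF f ≡ false
anyF-none {zero}  f h = refl
anyF-none {suc n} f h = cong₂ _∨_ (h F.zero) (anyF-none (f ∘ F.suc) (h ∘ F.suc))

anyF-cong : ∀ {n} (f g : Fin n → Bool) → (∀ a → f a ≡ g a) → anyF f ≡ anyF g
anyF-cong {zero}  f g h = refl
anyF-cong {suc n} f g h = cong₂ _∨_ (h F.zero) (anyF-cong (f ∘ F.suc) (g ∘ F.suc) (h ∘ F.suc))

pick : ∀ {n} (f : Fin n → Bool) → Fin n → Fin n
pick f default with FP.any? (λ w → f w B.≟ true)
... | yes (w , _) = w
... | no _        = default

pick-spec : ∀ {n} (f : Fin n → Bool) default → anyF f ≡ true → f (pick f default) ≡ true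
pick-spec f default p with FP.any? (λ w → f w B.≟ true)
... | yes (_ , q) = q
... | no none      = ⊥-elim (none (anyF-elim f p))

indicator : Bool → ℕ
indicator b = if b then 1 else 0

indicator-mono : ∀ a b → (a ≡ true → b ≡ true) → indicator a ≤ indicator b
indicator-mono false b       _ = z≤n
indicator-mono true  b       h with h refl
indicator-mono true  .true   _ | refl = ≤-refl

count-mono : ∀ {n} (f g : Fin n → Bool) → (∀ x → f x ≡ true → g x ≡ true) →
  count f ≤ count g
count-mono {zero}  f g h = z≤n
count-mono {suc n} f g h =
  +-mono-≤ (indicator-mono _ _ (h F.zero)) (count-mono (f ∘ F.suc) (g ∘ F.suc) (h ∘ F.suc))

count-strict : ∀ {n} (f g : Fin n → Bool) → (∀ x → f x ≡ true → g x ≡ true) →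
  ∀ a → g a ≡ true → f a ≡ false → count f < count g
count-strict {suc n} f g h F.zero ga fa rewrite ga | fa =
  s≤s (count-mono (f ∘ F.suc) (g ∘ F.suc) (h ∘ F.suc))
count-strict {suc n} f g h (F.suc a) ga fa =
  +-mono-≤-< (indicator-mono _ _ (h F.zero)) (count-strict (f ∘ F.suc) (g ∘ F.suc) (h ∘ F.suc) a ga fa)

count-pos : ∀ {n} (f : Fin n → Bool) a → f a ≡ true → 1 ≤ count f
count-pos f F.zero    p rewrite p = s≤s z≤n
count-pos f (F.suc a) p = ≤-trans (count-pos (f ∘ F.suc) a p) (m≤n+m _ _)

count-single : ∀ {n} (f : Fin n → Bool) a → f a ≡ true → (∀ y → f y ≡ true → y ≡ a) →
  count f ≡ 1
count-single {suc n} f F.zero p unique rewrite p =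
  cong suc (count-none (f ∘ F.suc) λ y → fZero y)
  where
  count-none : ∀ {m} (g : Fin m → Bool) → (∀ y → g y ≡ false) → count g ≡ 0
  count-none {zero}  g h = refl
  count-none {suc m} g h rewrite h F.zero = count-none (g ∘ F.suc) (h ∘ F.suc)
  fZero : ∀ y → f (F.suc y) ≡ false
  fZero y with bool-cases (f (F.suc y))
  ... | inj₁ q with () ← unique (F.suc y) q
  ... | inj₂ q = q
count-single {suc n} f (F.suc a) p unique with bool-cases (f F.zero)
... | inj₁ q with () ← unique F.zero q
... | inj₂ q rewrite q =
  count-single (f ∘ F.suc) a p (λ y r → FP.suc-injective (unique (F.suc y) r))

maxF-ub : ∀ {n} (f : Fin n → ℕ) i → f i ≤ maxF f
maxF-ub f F.zero    = m≤m⊔n _ _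
maxF-ub f (F.suc i) = ≤-trans (maxF-ub (f ∘ F.suc) i) (m≤n⊔m _ _)

-- Least d ≤ N with f d (valid when f N holds).

leastTrue : (ℕ → Bool) → ℕ → ℕ
leastTrue f zero    = zero
leastTrue f (suc N) = if f zero then zero else suc (leastTrue (f ∘ suc) N)

leastTrue-true : ∀ (f : ℕ → Bool) N → f N ≡ true → f (leastTrue f N) ≡ true
leastTrue-true f zero    p = p
leastTrue-true f (suc N) p with f zero in e
... | true  = e
... | false = leastTrue-true (f ∘ suc) N p

leastTrue-least : ∀ (f : ℕ → Bool) N d → f d ≡ true → leastTrue f N ≤ d
leastTrue-least f zero    d       p = z≤n
leastTrue-least f (suc N) d       p with f zero in e
... | true = z≤n
leastTrue-least f (suc N) zero    p | false = ⊥-elim (true≢false p e)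
leastTrue-least f (suc N) (suc d) p | false = s≤s (leastTrue-least (f ∘ suc) N d p)

-- A rooted forest on Fin n: every non-root vertex has a parent of strictly
-- smaller rank, so following parents always terminates at the root.
record Rooted (n : ℕ) (root : Fin n) : Set where
  field
    parent      : Fin n → Fin n
    rank        : Fin n → ℕ
    parent-rank : ∀ u → u ≢ root → rank (parent u) < rank u

-- Breadth-first search: in a connected graph every vertex other than the
-- root has a neighbour strictly closer to the root.
module BreadthFirst {n} (G : Graph n) (conn : Connected G) (root : Fin n) where

  -- within d u: u is joined to the root by a walk with at most d edges.
  within : ℕ → Fin n → Bool
  within zero    u = u ≟ᵇ root
  within (suc d) u = within d u ∨ anyF (λ w → within d w ∧ adj G w u)

  within-walk : ∀ x ws d u → Linked (Adj G) (x ∷ ws) → within d x ≡ true →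
    last (x ∷ ws) ≡ just u → within (d + length ws) u ≡ true
  within-walk x []       d .x _       p refl rewrite +-identityʳ d = p
  within-walk x (y ∷ ys) d u  (a ∷ l) p e  rewrite +-suc d (length ys) =
    within-walk y ys (suc d) u l
      (∨-introʳ (within d y) (anyF-intro (λ w → within d w ∧ adj G w y) x (∧-intro p a))) e

  reachable : ∀ u → Σ ℕ λ d → within d u ≡ true
  reachable u with conn root u
  ... | x ∷ ws , walk , refl , l =
    length ws , within-walk root ws 0 u walk (dec-true (root FP.≟ root) refl) l

  dist : Fin n → ℕ
  dist u = leastTrue (λ d → within d u) (proj₁ (reachable u))

  dist-within : ∀ u → within (dist u) u ≡ true
  dist-within u = leastTrue-true (λ d → within d u) (proj₁ (reachable u)) (proj₂ (reachable u))

  dist-least : ∀ u d → within d u ≡ true → dist u ≤ d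
  dist-least u = leastTrue-least (λ d → within d u) (proj₁ (reachable u))

  towards : Fin n → Fin n → Bool
  towards u w = within (pred (dist u)) w ∧ adj G w u

  parent : Fin n → Fin n
  parent u = pick (towards u) u

  dist-suc : ∀ u → u ≢ root → Σ ℕ λ d → dist u ≡ suc d
  dist-suc u u≢root with dist u in e
  ... | suc d = d , refl
  ... | zero  = ⊥-elim (u≢root (does-sound (u FP.≟ root) (subst (λ k → within k u ≡ true) e (dist-within u))))

  -- for u ≠ root the chosen parent exists: u is not within dist u - 1, so it
  -- has a neighbour that is
  parent-towards : ∀ u → u ≢ root → Σ ℕ λ d → dist u ≡ suc d × within d (parent u) ≡ true × Adj G (parent u) u
  parent-towards u u≢root with dist-suc u u≢root
  ... | d , e = d , e , ∧-elimˡ _ chosen , ∧-elimʳ (within d (parent u)) chosen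
    where
    some-towards : anyF (λ w → within d w ∧ adj G w u) ≡ true
    some-towards with ∨-elim (within d u) (subst (λ k → within k u ≡ true) e (dist-within u))
    ... | inj₁ p = ⊥-elim (1+n≰n (subst (_≤ d) e (dist-least u d p)))
    ... | inj₂ p = p
    chosen : within d (parent u) ∧ adj G (parent u) u ≡ true
    chosen = subst (λ k → within (pred k) (parent u) ∧ adj G (parent u) u ≡ true) e
      (pick-spec (towards u) u (subst (λ k → anyF (λ w → within (pred k) w ∧ adj G w u) ≡ true) (≡-sym e) some-towards))

  forest : Rooted n root
  forest = record
    { parent = parent
    ; rank = dist
    ; parent-rank = λ u u≢root → let (d , e , w , _) = parent-towards u u≢root in
        subst (dist (parent u) <_) (≡-sym e) (s≤s (dist-least (parent u) d w))
    }

  parent-adj : ∀ u → u ≢ root → Adj G u (parent u)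
  parent-adj u u≢root = trans (sym G u (parent u)) (proj₂ (proj₂ (proj₂ (parent-towards u u≢root))))

-- The pendant set of a rooted forest: a set of non-root vertices such that
-- a non-root vertex is pendant iff it has no pendant child.  It is computed
-- layer by layer from the leaves: with D the maximal rank, layer m is already
-- final on every y with D ∸ rank y ≤ m, so layer (D + 1) is a fixed point.
module Pendant {n} {root : Fin n} (R : Rooted n root) where
  open Rooted R

  nonRoot : Fin n → Bool
  nonRoot x = not (x ≟ᵇ root)

  nonRoot-root : nonRoot root ≡ false
  nonRoot-root rewrite dec-true (root FP.≟ root) refl = refl

  nonRoot-sound : ∀ x → nonRoot x ≡ true → x ≢ root
  nonRoot-sound x p refl = true≢false p nonRoot-root

  childIn : (Fin n → Bool) → Fin n → Fin n → Bool
  childIn S x z = S z ∧ (parent z ≟ᵇ x)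

  layer : ℕ → Fin n → Bool
  layer zero    x = nonRoot x
  layer (suc m) x = nonRoot x ∧ not (anyF (childIn (layer m) x))

  layer-nonRoot : ∀ m x → nonRoot x ≡ false → layer m x ≡ false
  layer-nonRoot zero    x p = p
  layer-nonRoot (suc m) x p rewrite p = refl

  D : ℕ
  D = maxF rank

  child-lower : ∀ z y → z ≢ root → parent z ≟ᵇ y ≡ true → D ∸ rank z < D ∸ rank y
  child-lower z y z≢root e with does-sound (parent z FP.≟ y) e
  ... | refl = ∸-monoʳ-< (parent-rank z z≢root) (maxF-ub rank z)

  -- layers m and m + 1 agree on y as soon as D ∸ rank y ≤ m: the children of
  -- y are strictly lower, so by induction they are already stable
  layer-stable : ∀ m y → D ∸ rank y ≤ m → layer m y ≡ layer (suc m) y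
  layer-stable zero y low =
    ≡-sym (trans (cong (λ b → nonRoot y ∧ not b) (anyF-none _ noChild)) (∧-identityʳ (nonRoot y)))
    where
    noChild : ∀ z → childIn nonRoot y z ≡ false
    noChild z with bool-cases (nonRoot z) | bool-cases (parent z ≟ᵇ y)
    ... | inj₂ p | _      rewrite p = refl
    ... | inj₁ _ | inj₂ q rewrite q = ∧-zeroʳ _
    ... | inj₁ p | inj₁ q = ⊥-elim (n≮0 (<-≤-trans (child-lower z y (nonRoot-sound z p) q) low))
  layer-stable (suc m) y low = cong (λ b → nonRoot y ∧ not b) (anyF-cong _ _ sameChildren)
    where
    sameChildren : ∀ z → childIn (layer m) y z ≡ childIn (layer (suc m)) y z
    sameChildren z with bool-cases (parent z ≟ᵇ y)
    ... | inj₂ q rewrite q = trans (∧-zeroʳ _) (≡-sym (∧-zeroʳ _))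
    ... | inj₁ q with bool-cases (nonRoot z)
    ...   | inj₂ r = cong (_∧ _) (trans (layer-nonRoot m z r) (≡-sym (layer-nonRoot (suc m) z r)))
    ...   | inj₁ r = cong (_∧ _) (layer-stable m z (≤-pred (≤-trans (child-lower z y (nonRoot-sound z r) q) low)))

  pendant : Fin n → Bool
  pendant = layer (suc D)

  pendant-fix : ∀ x → pendant x ≡ nonRoot x ∧ not (anyF (childIn pendant x))
  pendant-fix x = cong (λ b → nonRoot x ∧ not b)
    (anyF-cong _ _ λ z → cong (_∧ _) (layer-stable D z (m∸n≤m D (rank z))))

  pendant-nonRoot : ∀ x → pendant x ≡ true → x ≢ root
  pendant-nonRoot x p = nonRoot-sound x (∧-elimˡ _ (trans (≡-sym (pendant-fix x)) p))

  pendant-childless : ∀ x → pendant x ≡ true → ∀ z → childIn pendant x z ≡ false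
  pendant-childless x p = anyF-false _ (noChild (anyF (childIn pendant x))
    (∧-elimʳ (nonRoot x) (trans (≡-sym (pendant-fix x)) p)))
    where
    noChild : ∀ b → not b ≡ true → b ≡ false
    noChild false _ = refl

  pendant-child : ∀ x → x ≢ root → pendant x ≡ false → Σ (Fin n) (λ z → childIn pendant x z ≡ true)
  pendant-child x x≢root p = anyF-elim _ (someChild (anyF (childIn pendant x))
    (trans (≡-sym (cong (_∧ not (anyF (childIn pendant x))) isNonRoot)) (trans (≡-sym (pendant-fix x)) p)))
    where
    isNonRoot : nonRoot x ≡ true
    isNonRoot rewrite dec-false (x FP.≟ root) x≢root = refl
    someChild : ∀ b → true ∧ not b ≡ false → b ≡ true
    someChild true _ = refl

-- In a graph with only degrees ≤ k in which every edge has an end of degree 1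
-- (a star forest), colour the edge ab, with a of degree 1, by the position of
-- a among the neighbours of b.
module StarColouring {n} (H : Graph n) (k : ℕ)
    (degree≤k : ∀ x → degree H x ≤ k)
    (leafy : ∀ a b → Adj H a b → degree H a ≡ 1 ⊎ degree H b ≡ 1) where

  below : Fin n → Fin n → Bool
  below a x = does (toℕ x <? toℕ a)

  position : Fin n → Fin n → ℕ
  position a b = count (λ x → adj H b x ∧ below a x)

  below-irrefl : ∀ b a → adj H b a ∧ below a a ≡ false
  below-irrefl b a = trans (cong (adj H b a ∧_) (dec-false (toℕ a <? toℕ a) (<-irrefl refl))) (∧-zeroʳ (adj H b a))

  -- a neighbour's position is smaller than the degree, since it does not count itself
  position<degree : ∀ a b → Adj H b a → position a b < degree H b
  position<degree a b p = count-strict _ (adj H b) (λ x q → ∧-elimˡ _ q) a p (below-irrefl b a)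

  position-strict : ∀ a a' b → Adj H b a → toℕ a < toℕ a' → position a b < position a' b
  position-strict a a' b p a<a' = count-strict _ _
    (λ x q → ∧-intro (∧-elimˡ _ q)
      (dec-true (toℕ x <? toℕ a') (<-trans (does-sound (toℕ x <? toℕ a) (∧-elimʳ (adj H b x) q)) a<a')))
    a (∧-intro p (dec-true (toℕ a <? toℕ a') a<a')) (below-irrefl b a)

  position-injective : ∀ u w₁ w₂ → Adj H u w₁ → Adj H u w₂ → w₁ ≢ w₂ → position w₁ u ≢ position w₂ u
  position-injective u w₁ w₂ p q w₁≢w₂ with <-cmp (toℕ w₁) (toℕ w₂)
  ... | tri< lt _ _ = <⇒≢ (position-strict w₁ w₂ u p lt)
  ... | tri≈ _ eq _ = ⊥-elim (w₁≢w₂ (FP.toℕ-injective eq))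
  ... | tri> _ _ gt = ≢-sym (<⇒≢ (position-strict w₂ w₁ u q gt))

  position-zero : ∀ a b → Adj H b a → degree H b ≡ 1 → position a b ≡ 0
  position-zero a b p d = n<1⇒n≡0 (subst (position a b <_) d (position<degree a b p))

  colourOf : Fin n → Fin n → ℕ
  colourOf a b with degree H a ≟ 1
  ... | yes _ = position a b
  ... | no _  = position b a

  colour<k : ∀ a b → Adj H a b → colourOf a b < k
  colour<k a b p with degree H a ≟ 1
  ... | yes _ = <-≤-trans (position<degree a b (trans (sym H b a) p)) (degree≤k b)
  ... | no _  = <-≤-trans (position<degree b a p) (degree≤k a)

  colour-sym : ∀ a b → Adj H a b → colourOf a b ≡ colourOf b a
  colour-sym a b p with degree H a ≟ 1 | degree H b ≟ 1
  ... | yes da | yes db = trans (position-zero a b (trans (sym H b a) p) db) (≡-sym (position-zero b a p da))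
  ... | yes _  | no _   = refl
  ... | no _   | yes _  = refl
  ... | no da  | no db with leafy a b p
  ...   | inj₁ d = ⊥-elim (da d)
  ...   | inj₂ d = ⊥-elim (db d)

  colour-proper : ∀ u w₁ w₂ → Adj H u w₁ → Adj H u w₂ → w₁ ≢ w₂ → colourOf u w₁ ≢ colourOf u w₂
  colour-proper u w₁ w₂ p q w₁≢w₂ with degree H u ≟ 1
  ... | no _  = position-injective u w₁ w₂ p q w₁≢w₂
  ... | yes d = λ _ → position-injective u w₁ w₂ p q w₁≢w₂
                  (trans (position-zero w₁ u p d) (≡-sym (position-zero w₂ u q d)))

  colouring : EdgeColourable H k
  colouring = record
    { col = λ u w p → fromℕ< (colour<k u w p)
    ; col-sym = λ u w p q → FP.fromℕ<-cong _ _ (colour-sym u w p) (colour<k u w p) (colour<k w u q)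
    ; proper = λ u w₁ w₂ p q w₁≢w₂ same → colour-proper u w₁ w₂ p q w₁≢w₂
        (trans (≡-sym (FP.toℕ-fromℕ< (colour<k u w₁ p)))
          (trans (cong toℕ same) (FP.toℕ-fromℕ< (colour<k u w₂ q))))
    }

module StarForest {n} (G : Graph n) {root : Fin n} (R : Rooted n root)
    (parent-adj : ∀ u → u ≢ root → Adj G u (Rooted.parent R u)) where
  open Rooted R
  open Pendant R

  up : Fin n → Fin n → Bool
  up a b = pendant a ∧ (parent a ≟ᵇ b)

  up-parent : ∀ a b → up a b ≡ true → b ≡ parent a
  up-parent a b p = ≡-sym (does-sound (parent a FP.≟ b) (∧-elimʳ (pendant a) p))

  up-adj : ∀ a b → up a b ≡ true → Adj G a b
  up-adj a b p with up-parent a b p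
  ... | refl = parent-adj a (pendant-nonRoot a (∧-elimˡ _ p))

  up-irrefl : ∀ a → up a a ≡ false
  up-irrefl a with bool-cases (up a a)
  ... | inj₂ p = p
  ... | inj₁ p = ⊥-elim (true≢false (up-adj a a p) (irrefl G a))

  S : Graph n
  S = record
    { adj = λ a b → up a b ∨ up b a
    ; sym = λ a b → ∨-comm (up a b) (up b a)
    ; irrefl = λ a → cong₂ _∨_ (up-irrefl a) (up-irrefl a)
    }

  S-sub : IsSubgraph S G
  S-sub a b p with ∨-elim (up a b) p
  ... | inj₁ q = up-adj a b q
  ... | inj₂ q = trans (sym G a b) (up-adj b a q)

  pendant-degree : ∀ x → pendant x ≡ true → degree S x ≡ 1
  pendant-degree x px = count-single (adj S x) (parent x)
    (∨-introˡ _ (∧-intro px (dec-true (parent x FP.≟ parent x) refl))) onlyParent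
    where
    onlyParent : ∀ y → Adj S x y → y ≡ parent x
    onlyParent y p with ∨-elim (up x y) p
    ... | inj₁ q = up-parent x y q
    ... | inj₂ q = ⊥-elim (true≢false q (pendant-childless x px y))

  S-leafy : ∀ a b → Adj S a b → degree S a ≡ 1 ⊎ degree S b ≡ 1
  S-leafy a b p with ∨-elim (up a b) p
  ... | inj₁ q = inj₁ (pendant-degree a (∧-elimˡ _ q))
  ... | inj₂ q = inj₂ (pendant-degree b (∧-elimˡ _ q))

  -- a non-pendant, non-root vertex is not joined in S to its parent: the
  -- edge could only come from the parent being pendant with parent x, which
  -- would make rank decrease around a 2-cycle
  parent-edge-dropped : ∀ x → x ≢ root → pendant x ≡ false → adj S x (parent x) ≡ false
  parent-edge-dropped x x≢root px rewrite px with bool-cases (up (parent x) x)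
  ... | inj₂ q = q
  ... | inj₁ q with up-parent (parent x) x q
  ...   | x≡grandparent = ⊥-elim (<-irrefl (≡-sym (cong rank x≡grandparent))
          (<-trans (parent-rank (parent x) (pendant-nonRoot (parent x) (∧-elimˡ _ q))) (parent-rank x x≢root)))

  -- if all G-degrees are ≤ m, the root's is < m and m ≥ 2, then all S-degrees
  -- are < m: pendant vertices have degree 1, others lose their parent edge
  S-degree< : ∀ m → (∀ x → degree G x ≤ m) → degree G root < m → 2 ≤ m → ∀ x → degree S x < m
  S-degree< m deg≤m root< 2≤m x with bool-cases (pendant x)
  ... | inj₁ px = subst (_< m) (≡-sym (pendant-degree x px)) 2≤m
  ... | inj₂ px = nonPendant (x FP.≟ root)
    where
    nonPendant : Dec (x ≡ root) → degree S x < m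
    nonPendant (yes refl)   = ≤-<-trans (count-mono _ _ (S-sub root)) root<
    nonPendant (no x≢root) = <-≤-trans
      (count-strict _ _ (S-sub x) (parent x) (parent-adj x x≢root) (parent-edge-dropped x x≢root px))
      (deg≤m x)

  -- every non-root vertex is pendant or the centre of a pendant child
  S-covers : ∀ x → x ≢ root → Covered S x
  S-covers x x≢root with bool-cases (pendant x)
  ... | inj₁ px = subst (1 ≤_) (≡-sym (pendant-degree x px)) ≤-refl
  ... | inj₂ px with pendant-child x x≢root px
  ...   | z , q = count-pos (adj S x) z (∨-introʳ (up x z) q)

connected-degree-pos : ∀ {n} (G : Graph n) → Connected G → 2 ≤ n → ∀ v → 1 ≤ degree G v
connected-degree-pos {suc zero}    G conn (s≤s ()) v
connected-degree-pos {suc (suc m)} G conn _ v = neighbourTowards (other v) (other-≢ v)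
  where
  other : Fin (suc (suc m)) → Fin (suc (suc m))
  other F.zero    = F.suc F.zero
  other (F.suc _) = F.zero

  other-≢ : ∀ x → other x ≢ x
  other-≢ F.zero    ()
  other-≢ (F.suc _) ()

  -- the second vertex of a walk from v to u ≠ v is a neighbour of v
  neighbourTowards : ∀ u → u ≢ v → 1 ≤ degree G v
  neighbourTowards u u≢v with conn v u
  ... | _ ∷ []    , _       , refl , refl = ⊥-elim (u≢v refl)
  ... | _ ∷ w ∷ _ , (a ∷ _) , refl , _    = count-pos (adj G v) w a

mainTheorem6 : ∀ (n : ℕ) (T : Graph n) → IsTree T → 3 ≤ n →
    ∀ (v : Fin n) → degree T v < Δ T →
    Σ (Graph n) λ H → IsSubgraph H T × EdgeColourable H (Δ T ∸ 1) ×
    ((∀ (u : Fin n) → Covered H u)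
    ⊎ (¬ Covered H v × (∀ (u : Fin n) → u ≢ v → Covered H u)))
mainTheorem6 n T (conn , _) 3≤n v v<Δ = S , S-sub , colouring , cover
  where
  open BreadthFirst T conn v using (forest; parent-adj)
  open StarForest T forest parent-adj

  -- the root has a neighbour, and its degree is below Δ
  Δ≥2 : 2 ≤ Δ T
  Δ≥2 = ≤-trans (s≤s (connected-degree-pos T conn (≤-trans (n≤1+n 2) 3≤n) v)) v<Δ

  S<Δ : ∀ x → degree S x < Δ T
  S<Δ = S-degree< (Δ T) (maxF-ub (degree T)) v<Δ Δ≥2

  open StarColouring S (Δ T ∸ 1) (λ x → <⇒≤pred (S<Δ x)) S-leafy using (colouring)

  cover : (∀ u → Covered S u) ⊎ (¬ Covered S v × (∀ u → u ≢ v → Covered S u))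
  cover with 1 ≤? degree S v
  ... | no v-uncovered = inj₂ (v-uncovered , S-covers)
  ... | yes v-covered  = inj₁ λ u → coveredAt u (u FP.≟ v)
    where
    coveredAt : ∀ u → Dec (u ≡ v) → Covered S u
    coveredAt u (yes refl) = v-covered
    coveredAt u (no u≢v)   = S-covers u u≢v
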